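{- Let $k$ be a finite field of odd characteristic, $h$ a quadratic étale $k$-algebra (a quadratic field extension or $k\times k$) with conjugation $a\mapsto\bar a$ and norm $N$, and $\theta\in h^\times$ with $\bar\theta=-\theta$. Let $V_k$ be a $(2n+1)$-dimensional $k$-vector space with a nondegenerate symmetric bilinear form $\phi$, containing a hyperplane $W_k$ which is a free $h$-module of rank $n$ with $h$-basis $w_1,\dots,w_n$ such that $\phi(aw_i,bw_j)=\delta_{ij}\tfrac12\mathrm{Tr}_{h/k}(a\bar b)\phi(w_i,w_i)$ for $a,b\in h$; let $v_n\in W_k^\perp$ with $\phi(v_n,v_n)\ne0$, and put $v_{i-1}=\theta w_i$ ($1\le i\le n$), assuming $\phi(w_i,w_i)+\phi(v_i,v_i)=0$ for $1\le i\le n$. Put $e_{\pm i}=\frac12(v_i\pm w_i)$ for $1\le i\le n$, $e_0=v_0$, $f_i=e_{ -i}$ for $-n\le i\le n$, and $V_i=\bigoplus_{j\ge i}kf_j$. Then for every integer $1\le m\le n-1$ and every vector $u=\sum_{i=1}^mc_if_i$ with $c_i\in k$ and $c_m\neq0$, we have $\theta(u)\in V_{ -m-1}\setminus V_{ -m}$.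
   Context: For $1\le i\le n-1$, $f_i=\frac12(\theta w_{i+1}-w_i)\in W_k$, so $\theta(u)$ (the $h$-module action of $\theta$) is defined. -}

module Defs where

open import Level using (0ℓ)
open import Algebra.Bundles using (CommutativeRing)
open import Algebra.Module.Bundles using (Module)
open import Algebra.Morphism.Structures using (IsRingHomomorphism)
open import Data.Nat as ℕ using (ℕ; zero; suc)
open import Data.Fin as Fin using (Fin; toℕ; fromℕ<)
open import Data.Integer as ℤ using (ℤ; +_; -[1+_])
open import Data.Product using (Σ; ∃; ∃₂; _×_; _,_; proj₁; proj₂)
open import Data.Sum using (_⊎_)
open import Data.List using (List)
open import Data.List.Relation.Unary.Any using (Any)
open import Relation.Nullary using (¬_; yes; no)
open import Relation.Binary.PropositionalEquality using (_≡_; _≢_)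

CRing : Set₁
CRing = CommutativeRing 0ℓ 0ℓ

module _ (R : CRing) where
  open CommutativeRing R

  natMul : ℕ → Carrier → Carrier
  natMul zero    x = 0#
  natMul (suc k) x = x + natMul k x

  record IsField : Set where
    field
      1≉0     : ¬ (1# ≈ 0#)
      inverse : ∀ x → ¬ (x ≈ 0#) → ∃ λ y → x * y ≈ 1#

  IsFinite : Set
  IsFinite = ∃ λ (xs : List Carrier) → ∀ x → Any (x ≈_) xs

  HasCharacteristic : ℕ → Set
  HasCharacteristic p =
    (0 ℕ.< p) × (natMul p 1# ≈ 0#) × (∀ m → 0 ℕ.< m → m ℕ.< p → ¬ (natMul m 1# ≈ 0#))

  IsUnit : Carrier → Set
  IsUnit x = ∃ λ y → x * y ≈ 1#

Odd : ℕ → Set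
Odd p = ∃ λ k → p ≡ suc (k ℕ.+ k)

HasOddCharacteristic : CRing → Set
HasOddCharacteristic R = ∃ λ p → HasCharacteristic R p × Odd p

record IsFiniteFieldOddChar (K : CRing) : Set where
  field
    isField : IsField K
    finite  : IsFinite K
    oddChar : HasOddCharacteristic K

module _ (K H : CRing) (ι : CommutativeRing.Carrier K → CommutativeRing.Carrier H) where
  private
    module K = CommutativeRing K
    module H = CommutativeRing H

  _≈₂_ : K.Carrier × K.Carrier → K.Carrier × K.Carrier → Set
  (a , b) ≈₂ (c , d) = (a K.≈ c) × (b K.≈ d)

  record SplitIso : Set where
    field
      ψ       : H.Carrier → K.Carrier × K.Carrier
      ψ-cong  : ∀ {x y} → x H.≈ y → ψ x ≈₂ ψ y
      ψ-+     : ∀ x y → ψ (x H.+ y) ≈₂ (proj₁ (ψ x) K.+ proj₁ (ψ y) , proj₂ (ψ x) K.+ proj₂ (ψ y))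
      ψ-*     : ∀ x y → ψ (x H.* y) ≈₂ (proj₁ (ψ x) K.* proj₁ (ψ y) , proj₂ (ψ x) K.* proj₂ (ψ y))
      ψ-1     : ψ H.1# ≈₂ (K.1# , K.1#)
      ψ-ι     : ∀ c → ψ (ι c) ≈₂ (c , c)
      ψ-inj   : ∀ {x y} → ψ x ≈₂ ψ y → x H.≈ y
      ψ-surj  : ∀ a b → ∃ λ x → ψ x ≈₂ (a , b)

  record IsQuadraticEtale (conj : H.Carrier → H.Carrier) : Set where
    field
      ι-hom        : IsRingHomomorphism K.rawRing H.rawRing ι
      rank2        : ∃₂ λ b₁ b₂ →
                       (∀ x → ∃₂ λ a c → x H.≈ (ι a H.* b₁) H.+ (ι c H.* b₂))
                     × (∀ a c → (ι a H.* b₁) H.+ (ι c H.* b₂) H.≈ H.0# → (a K.≈ K.0#) × (c K.≈ K.0#))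
      fieldOrSplit : IsField H ⊎ SplitIso
      conj-hom     : IsRingHomomorphism H.rawRing H.rawRing conj
      conj-ι       : ∀ c → conj (ι c) H.≈ ι c
      conj-invol   : ∀ x → conj (conj x) H.≈ x
      conj-nontriv : ∃ λ x → ¬ (conj x H.≈ x)

module _ {R : CRing} (M : Module R 0ℓ 0ℓ) where
  open CommutativeRing R
  open Module M

  sumᴹ : ∀ {k} → (Fin k → Carrierᴹ) → Carrierᴹ
  sumᴹ {zero}  v = 0ᴹ
  sumᴹ {suc k} v = v Fin.zero +ᴹ sumᴹ (λ i → v (Fin.suc i))

  IsBasis : ∀ {k} → (Fin k → Carrierᴹ) → Set
  IsBasis {k} b =
      (∀ x → ∃ λ (c : Fin k → Carrier) → x ≈ᴹ sumᴹ (λ i → c i *ₗ b i))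
    × (∀ (c : Fin k → Carrier) → sumᴹ (λ i → c i *ₗ b i) ≈ᴹ 0ᴹ → ∀ i → c i ≈ 0#)

  HasDimension : ℕ → Set
  HasDimension d = ∃ λ (b : Fin d → Carrierᴹ) → IsBasis b

  record IsNondegSymBilinear (φ : Carrierᴹ → Carrierᴹ → Carrier) : Set where
    field
      φ-cong        : ∀ {x x' y y'} → x ≈ᴹ x' → y ≈ᴹ y' → φ x y ≈ φ x' y'
      φ-+ˡ          : ∀ x x' y → φ (x +ᴹ x') y ≈ φ x y + φ x' y
      φ-*ˡ          : ∀ c x y → φ (c *ₗ x) y ≈ c * φ x y
      φ-sym         : ∀ x y → φ x y ≈ φ y x
      nondegenerate : ∀ x → (∀ y → φ x y ≈ 0#) → x ≈ᴹ 0ᴹ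

pick : {A : Set} (n : ℕ) → (Fin n → A) → A → ℕ → A
pick n g d i with i ℕ.<? n
... | yes p = g (fromℕ< p)
... | no  _ = d

record Setup : Set₁ where
  field
    K       : CRing
    H       : CRing
    ι       : CommutativeRing.Carrier K → CommutativeRing.Carrier H
    conj    : CommutativeRing.Carrier H → CommutativeRing.Carrier H
  module K = CommutativeRing K
  module H = CommutativeRing H
  field
    K-ff    : IsFiniteFieldOddChar K
    H-qe    : IsQuadraticEtale K H ι conj
    θ       : H.Carrier
    θ-unit  : IsUnit H θ
    θ-conj  : conj θ H.≈ H.- θ
    half    : K.Carrier
    half-eq : half K.* (K.1# K.+ K.1#) K.≈ K.1#
    n       : ℕ
    V       : Module K 0ℓ 0ℓ
  module V = Module V
  field
    V-dim   : HasDimension V (2 ℕ.* n ℕ.+ 1)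
    φ       : V.Carrierᴹ → V.Carrierᴹ → K.Carrier
    φ-nd    : IsNondegSymBilinear V φ
    W       : Module H 0ℓ 0ℓ
  module W = Module W
  field
    j       : W.Carrierᴹ → V.Carrierᴹ
    j-cong  : ∀ {x y} → x W.≈ᴹ y → j x V.≈ᴹ j y
    j-+     : ∀ x y → j (x W.+ᴹ y) V.≈ᴹ j x V.+ᴹ j y
    j-*     : ∀ c x → j (ι c W.*ₗ x) V.≈ᴹ c V.*ₗ j x
    j-inj   : ∀ {x y} → j x V.≈ᴹ j y → x W.≈ᴹ y
    j-hyper : ∃ λ v₀ → (∀ x → ¬ (j x V.≈ᴹ v₀))
                     × (∀ y → ∃₂ λ c x → y V.≈ᴹ j x V.+ᴹ (c V.*ₗ v₀))
    -- h-basis w_1 … w_n of W_k  (w i  is  w_{i+1})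
    w       : Fin n → W.Carrierᴹ
    w-basis : IsBasis W w
    φ-w-same : ∀ i a b → ι (φ (j (a W.*ₗ w i)) (j (b W.*ₗ w i)))
                 H.≈ (ι half H.* ((a H.* conj b) H.+ conj (a H.* conj b))) H.* ι (φ (j (w i)) (j (w i)))
    φ-w-diff : ∀ i l → i ≢ l → ∀ a b → φ (j (a W.*ₗ w i)) (j (b W.*ₗ w l)) K.≈ K.0#
    vn       : V.Carrierᴹ
    vn-perp  : ∀ x → φ vn (j x) K.≈ K.0#
    vn-aniso : ¬ (φ vn vn K.≈ K.0#)

  vv : ℕ → V.Carrierᴹ
  vv i = pick n (λ k → j (θ W.*ₗ w k)) vn i

  field
    φ-wv     : ∀ (i : Fin n) → φ (j (w i)) (j (w i)) K.+ φ (vv (suc (toℕ i))) (vv (suc (toℕ i))) K.≈ K.0#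

  ww : ℕ → V.Carrierᴹ
  ww zero = V.0ᴹ
  ww (suc i) = pick n (λ k → j (w k)) V.0ᴹ i

  e⁺ e⁻ : ℕ → V.Carrierᴹ
  e⁺ i = half V.*ₗ (vv i V.+ᴹ ww i)
  e⁻ i = half V.*ₗ (vv i V.+ᴹ (V.-ᴹ ww i))

  f : ℤ → V.Carrierᴹ
  f (+ zero)    = vv 0
  f (+ suc i)   = e⁻ (suc i)
  f (-[1+ i ])  = e⁺ (suc i)

  idx : Fin (suc (n ℕ.+ n)) → ℤ
  idx p = + toℕ p ℤ.- + n

  InV : ℤ → V.Carrierᴹ → Set
  InV i x = ∃ λ (c : Fin (suc (n ℕ.+ n)) → K.Carrier) →
              (∀ p → idx p ℤ.< i → c p K.≈ K.0#)
            × (x V.≈ᴹ sumᴹ V (λ p → c p V.*ₗ f (idx p)))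

{-# OPTIONS --safe #-}
-- θ² = t is a nonzero scalar, so θ f_i = ½(t w_{i+1} - v_{i-1}) with w_{i+1} = f_{-(i+1)} - f_{i+1}:
-- modulo V_{-i}, θ f_i is ½ t f_{-(i+1)}. Hence θ(u) ∈ V_{-m-1}, and θ(u) ≡ ½ t c_m f_{-m-1} modulo V_{-m}.
-- Since v_0, …, v_n, w_1, …, w_n are pairwise orthogonal, the functional φ(-, f_{m+1}) kills V_{-m}
-- but takes the value ½ φ(v_{m+1}, v_{m+1}) ≠ 0 on f_{-m-1}, so θ(u) ∉ V_{-m}.
module Submission where

open import Defs
open import Level using (0ℓ)
open import Algebra.Bundles using (CommutativeRing; AbelianGroup)
open import Algebra.Module.Bundles using (Module)
open import Algebra.Morphism.Structures using (IsRingHomomorphism)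
open import Data.Nat as ℕ using (ℕ; zero; suc; _≤_; _<_)
open import Data.Integer as ℤ using (ℤ; +_; -[1+_])
import Data.Integer.Properties as ℤP
open import Data.Fin as Fin using (Fin; toℕ; fromℕ<)
import Data.Fin.Properties as FinP
import Data.Nat.Properties as ℕP
open import Data.Product using (Σ; ∃; _×_; _,_; proj₁; proj₂)
open import Function using (_∘_)
open import Data.Empty using (⊥-elim)
open import Relation.Nullary using (¬_; Dec; yes; no)
open import Relation.Binary.PropositionalEquality as P using (_≡_; _≢_)
import Relation.Binary.Reasoning.Setoid as SetoidReasoning
import Algebra.Properties.AbelianGroup as AbelianGroupProperties
import Algebra.Properties.CommutativeSemigroup as CommutativeSemigroupProperties
import Algebra.Properties.Ring as RingProperties

module CommutativeRingProperties (R : CRing) where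
  open CommutativeRing R
  open SetoidReasoning setoid

  unit-*-cancel : ∀ {a b} → IsUnit R a → a * b ≈ 0# → b ≈ 0#
  unit-*-cancel {a} {b} (a⁻¹ , aa⁻¹≈1) ab≈0 = begin
    b                ≈⟨ *-identityˡ b ⟨
    1# * b           ≈⟨ *-congʳ aa⁻¹≈1 ⟨
    (a * a⁻¹) * b    ≈⟨ *-congʳ (*-comm a a⁻¹) ⟩
    (a⁻¹ * a) * b    ≈⟨ *-assoc a⁻¹ a b ⟩
    a⁻¹ * (a * b)    ≈⟨ *-congˡ ab≈0 ⟩
    a⁻¹ * 0#         ≈⟨ zeroʳ a⁻¹ ⟩
    0#               ∎

  *-double-cancel : ∀ {h} → h * (1# + 1#) ≈ 1# → ∀ x → h * (x + x) ≈ x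
  *-double-cancel {h} h2≈1 x = begin
    h * (x + x)                ≈⟨ *-congˡ (+-cong (*-identityʳ x) (*-identityʳ x)) ⟨
    h * (x * 1# + x * 1#)      ≈⟨ *-congˡ (distribˡ x 1# 1#) ⟨
    h * (x * (1# + 1#))        ≈⟨ *-congˡ (*-comm x _) ⟩
    h * ((1# + 1#) * x)        ≈⟨ *-assoc _ _ _ ⟨
    (h * (1# + 1#)) * x        ≈⟨ *-congʳ h2≈1 ⟩
    1# * x                     ≈⟨ *-identityˡ x ⟩
    x                          ∎

+-‿cancelʳ : ∀ i j → (i ℤ.+ j) ℤ.- j ≡ i
+-‿cancelʳ i j = P.trans (ℤP.+-assoc i j (ℤ.- j))
                 (P.trans (P.cong (λ k → i ℤ.+ k) (ℤP.+-inverseʳ j)) (ℤP.+-identityʳ i))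

fromℕ<-≢ : ∀ {k l o} (k<o : k < o) (l<o : l < o) → k ≢ l → fromℕ< k<o ≢ fromℕ< l<o
fromℕ<-≢ {k} {l} k<o l<o k≢l eq = k≢l (FinP.fromℕ<-injective k l k<o l<o eq)

module FieldProperties (R : CRing) (isField : IsField R) where
  open CommutativeRing R
  open IsField isField
  open CommutativeRingProperties R

  nonzero-*-cancel : ∀ {a b} → ¬ a ≈ 0# → a * b ≈ 0# → b ≈ 0#
  nonzero-*-cancel a≉0 = unit-*-cancel (inverse _ a≉0)

  nonzero-* : ∀ {a b} → ¬ a ≈ 0# → ¬ b ≈ 0# → ¬ a * b ≈ 0#
  nonzero-* a≉0 b≉0 ab≈0 = b≉0 (nonzero-*-cancel a≉0 ab≈0)

module ModuleProperties {R : CRing} (M : Module R 0ℓ 0ℓ) where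
  open CommutativeRing R
  open Module M
  open SetoidReasoning ≈ᴹ-setoid
  open AbelianGroupProperties +ᴹ-abelianGroup using (⁻¹-∙-comm; ⁻¹-involutive; inverseʳ-unique)
  open CommutativeSemigroupProperties (AbelianGroup.commutativeSemigroup +ᴹ-abelianGroup) using (interchange)

  -ᴹ-+ᴹ : ∀ x y → -ᴹ (x +ᴹ y) ≈ᴹ -ᴹ x +ᴹ -ᴹ y
  -ᴹ-+ᴹ x y = ≈ᴹ-sym (⁻¹-∙-comm x y)

  *ₗ-negᴹ : ∀ a x → a *ₗ (-ᴹ x) ≈ᴹ -ᴹ (a *ₗ x)
  *ₗ-negᴹ a x = inverseʳ-unique (a *ₗ x) (a *ₗ (-ᴹ x)) (begin
    a *ₗ x +ᴹ a *ₗ (-ᴹ x) ≈⟨ *ₗ-distribˡ a x (-ᴹ x) ⟨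
    a *ₗ (x +ᴹ -ᴹ x)      ≈⟨ *ₗ-congˡ (-ᴹ‿inverseʳ x) ⟩
    a *ₗ 0ᴹ               ≈⟨ *ₗ-zeroʳ a ⟩
    0ᴹ                    ∎)

  -‿*ₗ : ∀ a x → (- a) *ₗ x ≈ᴹ -ᴹ (a *ₗ x)
  -‿*ₗ a x = inverseʳ-unique (a *ₗ x) ((- a) *ₗ x) (begin
    a *ₗ x +ᴹ (- a) *ₗ x ≈⟨ *ₗ-distribʳ x a (- a) ⟨
    (a + - a) *ₗ x       ≈⟨ *ₗ-congʳ (-‿inverseʳ a) ⟩
    0# *ₗ x              ≈⟨ *ₗ-zeroˡ x ⟩
    0ᴹ                   ∎)

  -ᴹ≈-1*ₗ : ∀ x → -ᴹ x ≈ᴹ (- 1#) *ₗ x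
  -ᴹ≈-1*ₗ x = ≈ᴹ-sym (≈ᴹ-trans (-‿*ₗ 1# x) (-ᴹ‿cong (*ₗ-identityˡ x)))

  sumᴹ-cong : ∀ {k} {u v : Fin k → Carrierᴹ} → (∀ p → u p ≈ᴹ v p) → sumᴹ M u ≈ᴹ sumᴹ M v
  sumᴹ-cong {zero}  u≈v = ≈ᴹ-refl
  sumᴹ-cong {suc k} u≈v = +ᴹ-cong (u≈v Fin.zero) (sumᴹ-cong (λ p → u≈v (Fin.suc p)))

  sumᴹ-+ᴹ : ∀ {k} (u v : Fin k → Carrierᴹ) → sumᴹ M (λ p → u p +ᴹ v p) ≈ᴹ sumᴹ M u +ᴹ sumᴹ M v
  sumᴹ-+ᴹ {zero}  u v = ≈ᴹ-sym (+ᴹ-identityˡ 0ᴹ)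
  sumᴹ-+ᴹ {suc k} u v = begin
    (u _ +ᴹ v _) +ᴹ sumᴹ M (λ p → u (Fin.suc p) +ᴹ v (Fin.suc p))
      ≈⟨ +ᴹ-congˡ (sumᴹ-+ᴹ (λ p → u (Fin.suc p)) (λ p → v (Fin.suc p))) ⟩
    (u _ +ᴹ v _) +ᴹ (sumᴹ M (λ p → u (Fin.suc p)) +ᴹ sumᴹ M (λ p → v (Fin.suc p)))
      ≈⟨ interchange _ _ _ _ ⟩
    sumᴹ M u +ᴹ sumᴹ M v ∎

  sumᴹ-*ₗ : ∀ {k} a (u : Fin k → Carrierᴹ) → sumᴹ M (λ p → a *ₗ u p) ≈ᴹ a *ₗ sumᴹ M u
  sumᴹ-*ₗ {zero}  a u = ≈ᴹ-sym (*ₗ-zeroʳ a)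
  sumᴹ-*ₗ {suc k} a u =
    ≈ᴹ-trans (+ᴹ-congˡ (sumᴹ-*ₗ a (λ p → u (Fin.suc p)))) (≈ᴹ-sym (*ₗ-distribˡ a _ _))

  sumᴹ-snoc : ∀ k (u : ℕ → Carrierᴹ) →
              sumᴹ M {suc k} (λ p → u (toℕ p)) ≈ᴹ sumᴹ M {k} (λ p → u (toℕ p)) +ᴹ u k
  sumᴹ-snoc zero    u = ≈ᴹ-trans (+ᴹ-identityʳ _) (≈ᴹ-sym (+ᴹ-identityˡ _))
  sumᴹ-snoc (suc k) u =
    ≈ᴹ-trans (+ᴹ-congˡ (sumᴹ-snoc k (λ i → u (suc i)))) (≈ᴹ-sym (+ᴹ-assoc _ _ _))

  *ₗ-*ₗ-+ᴹ-split : ∀ a b (x y z : Carrierᴹ) →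
                   a *ₗ (b *ₗ (x +ᴹ y) +ᴹ z) ≈ᴹ (a * b) *ₗ x +ᴹ a *ₗ (b *ₗ y +ᴹ z)
  *ₗ-*ₗ-+ᴹ-split a b x y z = begin
    a *ₗ (b *ₗ (x +ᴹ y) +ᴹ z)               ≈⟨ *ₗ-congˡ (+ᴹ-congʳ (*ₗ-distribˡ b x y)) ⟩
    a *ₗ ((b *ₗ x +ᴹ b *ₗ y) +ᴹ z)          ≈⟨ *ₗ-congˡ (+ᴹ-assoc _ _ _) ⟩
    a *ₗ (b *ₗ x +ᴹ (b *ₗ y +ᴹ z))          ≈⟨ *ₗ-distribˡ a _ _ ⟩
    a *ₗ (b *ₗ x) +ᴹ a *ₗ (b *ₗ y +ᴹ z)     ≈⟨ +ᴹ-congʳ (*ₗ-assoc a b x) ⟨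
    (a * b) *ₗ x +ᴹ a *ₗ (b *ₗ y +ᴹ z)      ∎

  module Halving (h : Carrier) (h-eq : h * (1# + 1#) ≈ 1#) where

    *ₗ-half-double : ∀ x → h *ₗ x +ᴹ h *ₗ x ≈ᴹ x
    *ₗ-half-double x = begin
      h *ₗ x +ᴹ h *ₗ x         ≈⟨ +ᴹ-cong (*ₗ-congˡ (*ₗ-identityˡ x)) (*ₗ-congˡ (*ₗ-identityˡ x)) ⟨
      h *ₗ (1# *ₗ x) +ᴹ h *ₗ (1# *ₗ x) ≈⟨ *ₗ-distribˡ h _ _ ⟨
      h *ₗ (1# *ₗ x +ᴹ 1# *ₗ x) ≈⟨ *ₗ-congˡ (*ₗ-distribʳ x 1# 1#) ⟨
      h *ₗ ((1# + 1#) *ₗ x)     ≈⟨ *ₗ-assoc h (1# + 1#) x ⟨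
      (h * (1# + 1#)) *ₗ x      ≈⟨ *ₗ-congʳ h-eq ⟩
      1# *ₗ x                   ≈⟨ *ₗ-identityˡ x ⟩
      x                         ∎

    half-sum+half-difference : ∀ a b → h *ₗ (a +ᴹ b) +ᴹ h *ₗ (a +ᴹ -ᴹ b) ≈ᴹ a
    half-sum+half-difference a b = begin
      h *ₗ (a +ᴹ b) +ᴹ h *ₗ (a +ᴹ -ᴹ b)              ≈⟨ +ᴹ-cong (*ₗ-distribˡ h a b) (*ₗ-distribˡ h a (-ᴹ b)) ⟩
      (h *ₗ a +ᴹ h *ₗ b) +ᴹ (h *ₗ a +ᴹ h *ₗ (-ᴹ b)) ≈⟨ interchange _ _ _ _ ⟩
      (h *ₗ a +ᴹ h *ₗ a) +ᴹ (h *ₗ b +ᴹ h *ₗ (-ᴹ b)) ≈⟨ +ᴹ-cong (*ₗ-half-double a) (+ᴹ-congˡ (*ₗ-negᴹ h b)) ⟩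
      a +ᴹ (h *ₗ b +ᴹ -ᴹ (h *ₗ b))                   ≈⟨ +ᴹ-congˡ (-ᴹ‿inverseʳ _) ⟩
      a +ᴹ 0ᴹ                                        ≈⟨ +ᴹ-identityʳ a ⟩
      a                                              ∎

    half-sum-half-difference : ∀ a b → h *ₗ (a +ᴹ b) +ᴹ -ᴹ (h *ₗ (a +ᴹ -ᴹ b)) ≈ᴹ b
    half-sum-half-difference a b = begin
      h *ₗ (a +ᴹ b) +ᴹ -ᴹ (h *ₗ (a +ᴹ -ᴹ b))  ≈⟨ +ᴹ-congˡ (*ₗ-negᴹ h _) ⟨
      h *ₗ (a +ᴹ b) +ᴹ h *ₗ (-ᴹ (a +ᴹ -ᴹ b))
        ≈⟨ +ᴹ-congˡ (*ₗ-congˡ (≈ᴹ-trans (-ᴹ-+ᴹ a (-ᴹ b)) (+ᴹ-congˡ (⁻¹-involutive b)))) ⟩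
      h *ₗ (a +ᴹ b) +ᴹ h *ₗ (-ᴹ a +ᴹ b)       ≈⟨ +ᴹ-cong (*ₗ-congˡ (+ᴹ-comm a b)) (*ₗ-congˡ (+ᴹ-comm _ b)) ⟩
      h *ₗ (b +ᴹ a) +ᴹ h *ₗ (b +ᴹ -ᴹ a)       ≈⟨ half-sum+half-difference b a ⟩
      b                                      ∎

  kronecker : ∀ {k} → Fin k → Fin k → Carrier
  kronecker Fin.zero    Fin.zero    = 1#
  kronecker Fin.zero    (Fin.suc p) = 0#
  kronecker (Fin.suc q) Fin.zero    = 0#
  kronecker (Fin.suc q) (Fin.suc p) = kronecker q p

  kronecker-≢ : ∀ {k} (q p : Fin k) → p ≢ q → kronecker q p ≈ 0#
  kronecker-≢ Fin.zero    Fin.zero    p≢q = ⊥-elim (p≢q P.refl)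
  kronecker-≢ Fin.zero    (Fin.suc p) p≢q = refl
  kronecker-≢ (Fin.suc q) Fin.zero    p≢q = refl
  kronecker-≢ (Fin.suc q) (Fin.suc p) p≢q = kronecker-≢ q p (λ p≡q → p≢q (P.cong Fin.suc p≡q))

  sumᴹ-zero : ∀ {k} {u : Fin k → Carrierᴹ} → (∀ p → u p ≈ᴹ 0ᴹ) → sumᴹ M u ≈ᴹ 0ᴹ
  sumᴹ-zero {zero}  u≈0 = ≈ᴹ-refl
  sumᴹ-zero {suc k} u≈0 =
    ≈ᴹ-trans (+ᴹ-cong (u≈0 Fin.zero) (sumᴹ-zero (λ p → u≈0 (Fin.suc p)))) (+ᴹ-identityˡ 0ᴹ)

  sumᴹ-kronecker : ∀ {k} (q : Fin k) (u : Fin k → Carrierᴹ) → sumᴹ M (λ p → kronecker q p *ₗ u p) ≈ᴹ u q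
  sumᴹ-kronecker {suc k} Fin.zero    u =
    ≈ᴹ-trans (+ᴹ-cong (*ₗ-identityˡ _) (sumᴹ-zero {k} (λ p → *ₗ-zeroˡ (u (Fin.suc p))))) (+ᴹ-identityʳ _)
  sumᴹ-kronecker {suc k} (Fin.suc q) u =
    ≈ᴹ-trans (+ᴹ-cong (*ₗ-zeroˡ _) (sumᴹ-kronecker q (λ p → u (Fin.suc p)))) (+ᴹ-identityˡ _)

record IsLinearFunctional {R : CRing} (M : Module R 0ℓ 0ℓ)
                          (ψ : Module.Carrierᴹ M → CommutativeRing.Carrier R) : Set where
  open CommutativeRing R
  open Module M
  field
    cong    : ∀ {x y} → x ≈ᴹ y → ψ x ≈ ψ y
    +ᴹ-homo : ∀ x y → ψ (x +ᴹ y) ≈ ψ x + ψ y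
    *ₗ-homo : ∀ a x → ψ (a *ₗ x) ≈ a * ψ x

  open SetoidReasoning setoid
  open ModuleProperties M using (-ᴹ≈-1*ₗ)
  private module RP = RingProperties ring

  0ᴹ-homo : ψ 0ᴹ ≈ 0#
  0ᴹ-homo = begin
    ψ 0ᴹ          ≈⟨ cong (*ₗ-zeroˡ 0ᴹ) ⟨
    ψ (0# *ₗ 0ᴹ)  ≈⟨ *ₗ-homo 0# 0ᴹ ⟩
    0# * ψ 0ᴹ     ≈⟨ zeroˡ _ ⟩
    0#            ∎

  -ᴹ-homo : ∀ x → ψ (-ᴹ x) ≈ - ψ x
  -ᴹ-homo x = begin
    ψ (-ᴹ x)          ≈⟨ cong (-ᴹ≈-1*ₗ x) ⟩
    ψ ((- 1#) *ₗ x)   ≈⟨ *ₗ-homo _ x ⟩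
    (- 1#) * ψ x      ≈⟨ RP.-1*x≈-x _ ⟩
    - ψ x             ∎

  *ₗ-+ᴹ-homo : ∀ h x y → ψ (h *ₗ (x +ᴹ y)) ≈ h * (ψ x + ψ y)
  *ₗ-+ᴹ-homo h x y = trans (*ₗ-homo h _) (*-congˡ (+ᴹ-homo x y))

  *ₗ-sub-homo : ∀ h x y → ψ (h *ₗ (x +ᴹ -ᴹ y)) ≈ h * (ψ x - ψ y)
  *ₗ-sub-homo h x y = trans (*ₗ-+ᴹ-homo h x (-ᴹ y)) (*-congˡ (+-congˡ (-ᴹ-homo y)))

  sumᴹ-zero-homo : ∀ {k} (u : Fin k → Carrierᴹ) → (∀ p → ψ (u p) ≈ 0#) → ψ (sumᴹ M u) ≈ 0#
  sumᴹ-zero-homo {zero}  u ψu≈0 = 0ᴹ-homo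
  sumᴹ-zero-homo {suc k} u ψu≈0 = begin
    ψ (u Fin.zero +ᴹ sumᴹ M (λ p → u (Fin.suc p)))       ≈⟨ +ᴹ-homo _ _ ⟩
    ψ (u Fin.zero) + ψ (sumᴹ M (λ p → u (Fin.suc p)))
      ≈⟨ +-cong (ψu≈0 Fin.zero) (sumᴹ-zero-homo _ (λ p → ψu≈0 (Fin.suc p))) ⟩
    0# + 0#                                              ≈⟨ +-identityˡ 0# ⟩
    0#                                                   ∎

module BilinearProperties {R : CRing} {M : Module R 0ℓ 0ℓ}
                          {φ : Module.Carrierᴹ M → Module.Carrierᴹ M → CommutativeRing.Carrier R}
                          (φ-nd : IsNondegSymBilinear M φ) where
  open CommutativeRing R
  open Module M
  open IsNondegSymBilinear φ-nd

  φ-linearˡ : ∀ y → IsLinearFunctional M (λ x → φ x y)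
  φ-linearˡ y = record
    { cong    = λ x≈x' → φ-cong x≈x' ≈ᴹ-refl
    ; +ᴹ-homo = λ x x' → φ-+ˡ x x' y
    ; *ₗ-homo = λ a x → φ-*ˡ a x y
    }

  φ-linearʳ : ∀ x → IsLinearFunctional M (φ x)
  φ-linearʳ x = record
    { cong    = λ y≈y' → φ-cong ≈ᴹ-refl y≈y'
    ; +ᴹ-homo = λ y y' → trans (φ-sym x _) (trans (φ-+ˡ y y' x) (+-cong (φ-sym y x) (φ-sym y' x)))
    ; *ₗ-homo = λ a y → trans (φ-sym x _) (trans (φ-*ˡ a y x) (*-congˡ (φ-sym y x)))
    }

module Span {R : CRing} (M : Module R 0ℓ 0ℓ) {N : ℕ} (g : Fin N → Module.Carrierᴹ M) where
  open CommutativeRing R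
  open Module M
  open ModuleProperties M

  InSpan : (Fin N → Set) → Carrierᴹ → Set
  InSpan Excluded x = ∃ λ (c : Fin N → Carrier) →
                        (∀ p → Excluded p → c p ≈ 0#) × (x ≈ᴹ sumᴹ M (λ p → c p *ₗ g p))

  module _ {E : Fin N → Set} where

    InSpan-cong : ∀ {x y} → x ≈ᴹ y → InSpan E x → InSpan E y
    InSpan-cong x≈y (c , c≈0 , x≈) = c , c≈0 , ≈ᴹ-trans (≈ᴹ-sym x≈y) x≈

    InSpan-0ᴹ : InSpan E 0ᴹ
    InSpan-0ᴹ = (λ _ → 0#) , (λ _ _ → refl) , ≈ᴹ-sym (sumᴹ-zero (λ p → *ₗ-zeroˡ (g p)))

    InSpan-+ᴹ : ∀ {x y} → InSpan E x → InSpan E y → InSpan E (x +ᴹ y)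
    InSpan-+ᴹ (c , c≈0 , x≈) (d , d≈0 , y≈) =
      (λ p → c p + d p) ,
      (λ p Ep → trans (+-cong (c≈0 p Ep) (d≈0 p Ep)) (+-identityˡ 0#)) ,
      ≈ᴹ-trans (+ᴹ-cong x≈ y≈)
        (≈ᴹ-trans (≈ᴹ-sym (sumᴹ-+ᴹ (λ p → c p *ₗ g p) (λ p → d p *ₗ g p)))
                  (sumᴹ-cong (λ p → ≈ᴹ-sym (*ₗ-distribʳ (g p) (c p) (d p)))))

    InSpan-*ₗ : ∀ a {x} → InSpan E x → InSpan E (a *ₗ x)
    InSpan-*ₗ a (c , c≈0 , x≈) =
      (λ p → a * c p) ,
      (λ p Ep → trans (*-congˡ (c≈0 p Ep)) (zeroʳ a)) ,
      ≈ᴹ-trans (*ₗ-congˡ x≈)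
        (≈ᴹ-trans (≈ᴹ-sym (sumᴹ-*ₗ a (λ p → c p *ₗ g p)))
                  (sumᴹ-cong (λ p → ≈ᴹ-sym (*ₗ-assoc a (c p) (g p)))))

    InSpan-negᴹ : ∀ {x} → InSpan E x → InSpan E (-ᴹ x)
    InSpan-negᴹ x∈ = InSpan-cong (≈ᴹ-sym (-ᴹ≈-1*ₗ _)) (InSpan-*ₗ (- 1#) x∈)

    InSpan-sumᴹ : ∀ {k} (u : Fin k → Carrierᴹ) → (∀ p → InSpan E (u p)) → InSpan E (sumᴹ M u)
    InSpan-sumᴹ {zero}  u u∈ = InSpan-0ᴹ
    InSpan-sumᴹ {suc k} u u∈ = InSpan-+ᴹ (u∈ Fin.zero) (InSpan-sumᴹ _ (λ p → u∈ (Fin.suc p)))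

    InSpan-generator : ∀ q → ¬ E q → InSpan E (g q)
    InSpan-generator q ¬Eq = kronecker q , excluded , ≈ᴹ-sym (sumᴹ-kronecker q g)
      where
      excluded : ∀ p → E p → kronecker q p ≈ 0#
      excluded p Ep with p FinP.≟ q
      ... | yes P.refl = ⊥-elim (¬Eq Ep)
      ... | no  p≢q    = kronecker-≢ q p p≢q

    InSpan-weaken : ∀ {E' : Fin N → Set} → (∀ p → E' p → E p) → ∀ {x} → InSpan E x → InSpan E' x
    InSpan-weaken E'⊆E (c , c≈0 , x≈) = c , (λ p E'p → c≈0 p (E'⊆E p E'p)) , x≈

    InSpan-annihilated : (∀ p → Dec (E p)) → ∀ {ψ} → IsLinearFunctional M ψ →
                         (∀ p → ¬ E p → ψ (g p) ≈ 0#) → ∀ {x} → InSpan E x → ψ x ≈ 0#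
    InSpan-annihilated E? {ψ} ψ-lin ψg≈0 (c , c≈0 , x≈) =
      trans (cong x≈) (sumᴹ-zero-homo _ term≈0)
      where
      open IsLinearFunctional ψ-lin
      term≈0 : ∀ p → ψ (c p *ₗ g p) ≈ 0#
      term≈0 p with E? p
      ... | yes Ep  = trans (*ₗ-homo _ _) (trans (*-congʳ (c≈0 p Ep)) (zeroˡ _))
      ... | no  ¬Ep = trans (*ₗ-homo _ _) (trans (*-congˡ (ψg≈0 p ¬Ep)) (zeroʳ _))

module SetupProperties (S : Setup) where
  open Setup S
  open IsQuadraticEtale H-qe
  open IsNondegSymBilinear φ-nd
  open BilinearProperties φ-nd
  open FieldProperties K (IsFiniteFieldOddChar.isField K-ff)
  open IsField (IsFiniteFieldOddChar.isField K-ff) using (1≉0)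
  private
    module ιᴴ    = IsRingHomomorphism ι-hom
    module conjᴴ = IsRingHomomorphism conj-hom
    module KP    = RingProperties K.ring
    module HP    = RingProperties H.ring
    module VP    = ModuleProperties V
    module WP    = ModuleProperties W

  ι≈0⇒≈0 : ∀ {a} → ι a H.≈ H.0# → a K.≈ K.0#
  ι≈0⇒≈0 {a} ιa≈0 with rank2
  ... | b₁ , b₂ , _ , independent = proj₁ (independent a K.0# (begin
    ι a H.* b₁ H.+ ι K.0# H.* b₂ ≈⟨ H.+-cong (H.*-congʳ ιa≈0) (H.*-congʳ ιᴴ.0#-homo) ⟩
    H.0# H.* b₁ H.+ H.0# H.* b₂  ≈⟨ H.+-cong (H.zeroˡ b₁) (H.zeroˡ b₂) ⟩
    H.0# H.+ H.0#                ≈⟨ H.+-identityˡ H.0# ⟩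
    H.0#                         ∎))
    where open SetoidReasoning H.setoid

  ι-half-double : ∀ x → ι half H.* (x H.+ x) H.≈ x
  ι-half-double = CommutativeRingProperties.*-double-cancel H (begin
      ι half H.* (H.1# H.+ H.1#)        ≈⟨ H.*-congˡ (H.+-cong ιᴴ.1#-homo ιᴴ.1#-homo) ⟨
      ι half H.* (ι K.1# H.+ ι K.1#)    ≈⟨ H.*-congˡ (ιᴴ.+-homo K.1# K.1#) ⟨
      ι half H.* ι (K.1# K.+ K.1#)      ≈⟨ ιᴴ.*-homo half _ ⟨
      ι (half K.* (K.1# K.+ K.1#))      ≈⟨ ιᴴ.⟦⟧-cong half-eq ⟩
      ι K.1#                            ≈⟨ ιᴴ.1#-homo ⟩
      H.1#                              ∎)
    where open SetoidReasoning H.setoid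

  half≉0 : ¬ half K.≈ K.0#
  half≉0 half≈0 = 1≉0 (K.trans (K.sym half-eq) (K.trans (K.*-congʳ half≈0) (K.zeroˡ _)))

  half-double : ∀ a → half K.* a K.+ half K.* a K.≈ a
  half-double a = K.trans (K.sym (K.distribˡ half a a)) (CommutativeRingProperties.*-double-cancel K half-eq a)

  θθ-cancel : ∀ {x} → (θ H.* θ) H.* x H.≈ H.0# → x H.≈ H.0#
  θθ-cancel θθx≈0 =
    unit-*-cancel θ-unit (unit-*-cancel θ-unit (H.trans (H.sym (H.*-assoc θ θ _)) θθx≈0))
    where open CommutativeRingProperties H

  conj-θθ : conj (θ H.* θ) H.≈ θ H.* θ
  conj-θθ = begin
    conj (θ H.* θ)         ≈⟨ conjᴴ.*-homo θ θ ⟩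
    conj θ H.* conj θ      ≈⟨ H.*-cong θ-conj θ-conj ⟩
    (H.- θ) H.* (H.- θ)    ≈⟨ HP.-‿distribˡ-* θ _ ⟨
    H.- (θ H.* (H.- θ))    ≈⟨ H.-‿cong (HP.-‿distribʳ-* θ θ) ⟨
    H.- (H.- (θ H.* θ))    ≈⟨ HP.-‿involutive _ ⟩
    θ H.* θ                ∎
    where open SetoidReasoning H.setoid

  φw² : Fin n → K.Carrier
  φw² a = φ (j (w a)) (j (w a))

  φ-line : ∀ a x y T → (x H.* conj y) H.+ conj (x H.* conj y) H.≈ T H.+ T →
           ι (φ (j (x W.*ₗ w a)) (j (y W.*ₗ w a))) H.≈ T H.* ι (φw² a)
  φ-line a x y T tr≈2T =
    H.trans (φ-w-same a x y) (H.*-congʳ (H.trans (H.*-congˡ tr≈2T) (ι-half-double T)))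

  j-1*ₗ : ∀ x → j (H.1# W.*ₗ x) V.≈ᴹ j x
  j-1*ₗ x = j-cong (W.*ₗ-identityˡ x)

  *-conj-1 : ∀ x → x H.* conj H.1# H.≈ x
  *-conj-1 x = H.trans (H.*-congˡ conjᴴ.1#-homo) (H.*-identityʳ x)

  φ-θw-w-same : ∀ a → φ (j (θ W.*ₗ w a)) (j (w a)) K.≈ K.0#
  φ-θw-w-same a = K.trans (φ-cong V.≈ᴹ-refl (V.≈ᴹ-sym (j-1*ₗ (w a))))
    (ι≈0⇒≈0 (H.trans (φ-line a θ H.1# H.0# trθ≈0) (H.zeroˡ _)))
    where
    open SetoidReasoning H.setoid
    trθ≈0 : (θ H.* conj H.1#) H.+ conj (θ H.* conj H.1#) H.≈ H.0# H.+ H.0#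
    trθ≈0 = begin
      (θ H.* conj H.1#) H.+ conj (θ H.* conj H.1#)
        ≈⟨ H.+-cong (*-conj-1 θ) (H.trans (conjᴴ.⟦⟧-cong (*-conj-1 θ)) θ-conj) ⟩
      θ H.+ H.- θ                                  ≈⟨ H.-‿inverseʳ θ ⟩
      H.0#                                         ≈⟨ H.+-identityˡ H.0# ⟨
      H.0# H.+ H.0#                                ∎

  ι-φ-θw-θw : ∀ a → ι (φ (j (θ W.*ₗ w a)) (j (θ W.*ₗ w a))) H.≈ (H.- (θ H.* θ)) H.* ι (φw² a)
  ι-φ-θw-θw a = φ-line a θ θ (H.- (θ H.* θ)) (H.+-cong θθ̄≈-θθ
    (H.trans (conjᴴ.⟦⟧-cong θθ̄≈-θθ) (H.trans (conjᴴ.-‿homo _) (H.-‿cong conj-θθ))))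
    where
    θθ̄≈-θθ : θ H.* conj θ H.≈ H.- (θ H.* θ)
    θθ̄≈-θθ = H.trans (H.*-congˡ θ-conj) (H.sym (HP.-‿distribʳ-* θ θ))

  ι-φ-θθw-w : ∀ a → ι (φ (j ((θ H.* θ) W.*ₗ w a)) (j (w a))) H.≈ (θ H.* θ) H.* ι (φw² a)
  ι-φ-θθw-w a = H.trans (ιᴴ.⟦⟧-cong (φ-cong V.≈ᴹ-refl (V.≈ᴹ-sym (j-1*ₗ (w a)))))
    (φ-line a (θ H.* θ) H.1# (θ H.* θ)
      (H.+-cong (*-conj-1 _) (H.trans (conjᴴ.⟦⟧-cong (*-conj-1 _)) conj-θθ)))

  φ-w-w-≢ : ∀ a b → a ≢ b → φ (j (w a)) (j (w b)) K.≈ K.0#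
  φ-w-w-≢ a b a≢b =
    K.trans (φ-cong (V.≈ᴹ-sym (j-1*ₗ (w a))) (V.≈ᴹ-sym (j-1*ₗ (w b)))) (φ-w-diff a b a≢b H.1# H.1#)

  φ-θw-w : ∀ a b → φ (j (θ W.*ₗ w a)) (j (w b)) K.≈ K.0#
  φ-θw-w a b with a FinP.≟ b
  ... | yes P.refl = φ-θw-w-same a
  ... | no  a≢b    = K.trans (φ-cong V.≈ᴹ-refl (V.≈ᴹ-sym (j-1*ₗ (w b)))) (φ-w-diff a b a≢b θ H.1#)

  φ-zeroʳ : ∀ x → φ x V.0ᴹ K.≈ K.0#
  φ-zeroʳ x = IsLinearFunctional.0ᴹ-homo (φ-linearʳ x)

  φ-vv-ww : ∀ k l → φ (vv k) (ww l) K.≈ K.0#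
  φ-vv-ww k zero = φ-zeroʳ (vv k)
  φ-vv-ww k (suc l) with l ℕ.<? n
  ... | no  _ = φ-zeroʳ (vv k)
  ... | yes _ with k ℕ.<? n
  ...   | yes _ = φ-θw-w _ _
  ...   | no  _ = vn-perp _

  φ-ww-ww : ∀ k l → k ≢ l → φ (ww k) (ww l) K.≈ K.0#
  φ-ww-ww k zero _ = φ-zeroʳ (ww k)
  φ-ww-ww zero (suc l) _ = K.trans (φ-sym _ _) (φ-zeroʳ (ww (suc l)))
  φ-ww-ww (suc k) (suc l) k≢l with k ℕ.<? n | l ℕ.<? n
  ... | yes k<n | yes l<n = φ-w-w-≢ _ _ (fromℕ<-≢ k<n l<n (λ k≡l → k≢l (P.cong suc k≡l)))
  ... | yes _   | no  _   = φ-zeroʳ _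
  ... | no  _   | _       = K.trans (φ-sym _ _) (φ-zeroʳ _)

  φ-vv-vv : ∀ k l → k ≢ l → k ≤ n → l ≤ n → φ (vv k) (vv l) K.≈ K.0#
  φ-vv-vv k l k≢l k≤n l≤n with k ℕ.<? n | l ℕ.<? n
  ... | yes k<n | yes l<n = φ-w-diff _ _ (fromℕ<-≢ k<n l<n k≢l) θ θ
  ... | yes _   | no  _   = K.trans (φ-sym _ _) (vn-perp _)
  ... | no  _   | yes _   = vn-perp _
  ... | no  k≮n | no  l≮n =
    ⊥-elim (k≢l (P.trans (ℕP.≤-antisym k≤n (ℕP.≮⇒≥ k≮n)) (ℕP.≤-antisym (ℕP.≮⇒≥ l≮n) l≤n)))

  private
    +≈0-cancelʳ : ∀ {a b} → a K.+ b K.≈ K.0# → a K.≈ K.0# → b K.≈ K.0#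
    +≈0-cancelʳ {a} {b} a+b≈0 a≈0 = K.trans (K.sym (K.+-identityˡ b)) (K.trans (K.+-congʳ (K.sym a≈0)) a+b≈0)

    -‿*≈0 : ∀ {x y} → (H.- x) H.* y H.≈ H.0# → x H.* y H.≈ H.0#
    -‿*≈0 {x} {y} -xy≈0 = H.trans (H.sym (HP.-‿involutive _))
      (H.trans (H.-‿cong (H.trans (HP.-‿distribˡ-* x y) -xy≈0)) HP.-0#≈0#)

  θw-isotropic⇒w-isotropic : ∀ a → φ (j (θ W.*ₗ w a)) (j (θ W.*ₗ w a)) K.≈ K.0# → φw² a K.≈ K.0#
  θw-isotropic⇒w-isotropic a iso = ι≈0⇒≈0 (θθ-cancel (-‿*≈0
    (H.trans (H.sym (ι-φ-θw-θw a)) (H.trans (ιᴴ.⟦⟧-cong iso) ιᴴ.0#-homo))))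

  -- Anisotropy propagates down from v_n: φ(v_{i-1}, v_{i-1}) = -θ² φ(w_i, w_i) = θ² φ(v_i, v_i).
  vv-anisotropic-from : ∀ d k → k ℕ.+ d ≡ n → ¬ φ (vv k) (vv k) K.≈ K.0#
  vv-anisotropic-from zero k k+0≡n iso with k ℕ.<? n
  ... | yes k<n = ℕP.<-irrefl (P.trans (P.sym (ℕP.+-identityʳ k)) k+0≡n) k<n
  ... | no  _   = vn-aniso iso
  vv-anisotropic-from (suc d) k k+1+d≡n iso with k ℕ.<? n
  ... | no  k≮n = k≮n (P.subst (k <_) k+1+d≡n (ℕP.m<m+n k (ℕ.s≤s ℕ.z≤n)))
  ... | yes k<n = vv-anisotropic-from d (suc (toℕ a)) next≡n
        (+≈0-cancelʳ (φ-wv a) (θw-isotropic⇒w-isotropic a iso))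
    where
    a : Fin n
    a = fromℕ< k<n
    next≡n : suc (toℕ a) ℕ.+ d ≡ n
    next≡n = P.trans (P.cong (λ i → suc i ℕ.+ d) (FinP.toℕ-fromℕ< k<n))
                     (P.trans (P.sym (ℕP.+-suc k d)) k+1+d≡n)

  vv-anisotropic : ∀ k → k ≤ n → ¬ φ (vv k) (vv k) K.≈ K.0#
  vv-anisotropic k k≤n = vv-anisotropic-from (n ℕ.∸ k) k (ℕP.m+[n∸m]≡n k≤n)

  w-anisotropic : ∀ a → ¬ φw² a K.≈ K.0#
  w-anisotropic a iso = vv-anisotropic (suc (toℕ a)) (FinP.toℕ<n a) (+≈0-cancelʳ (φ-wv a) iso)

  φ-ww+φ-vv : ∀ k → k < n → φ (ww (suc k)) (ww (suc k)) K.+ φ (vv (suc k)) (vv (suc k)) K.≈ K.0#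
  φ-ww+φ-vv k k<n with k ℕ.<? n
  ... | no  k≮n  = ⊥-elim (k≮n k<n)
  ... | yes k<n' = P.subst (λ i → φw² (fromℕ< k<n') K.+ φ (vv (suc i)) (vv (suc i)) K.≈ K.0#)
                           (FinP.toℕ-fromℕ< k<n') (φ-wv (fromℕ< k<n'))

  -- θ² is read off from φ(θ² w_a, w_a) = θ² φ(w_a, w_a), using φ(w_a, w_a) ≠ 0.
  θ²-scalar : Fin n → Σ K.Carrier (λ t → ι t H.≈ θ H.* θ)
  θ²-scalar a with IsField.inverse (IsFiniteFieldOddChar.isField K-ff) (φw² a) (w-anisotropic a)
  ... | r , φw²a*r≈1 = φ (j ((θ H.* θ) W.*ₗ w a)) (j (w a)) K.* r , (begin
    ι (φ (j ((θ H.* θ) W.*ₗ w a)) (j (w a)) K.* r)      ≈⟨ ιᴴ.*-homo _ r ⟩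
    ι (φ (j ((θ H.* θ) W.*ₗ w a)) (j (w a))) H.* ι r   ≈⟨ H.*-congʳ (ι-φ-θθw-w a) ⟩
    ((θ H.* θ) H.* ι (φw² a)) H.* ι r                  ≈⟨ H.*-assoc _ _ _ ⟩
    (θ H.* θ) H.* (ι (φw² a) H.* ι r)                  ≈⟨ H.*-congˡ (ιᴴ.*-homo _ r) ⟨
    (θ H.* θ) H.* ι (φw² a K.* r)                      ≈⟨ H.*-congˡ (H.trans (ιᴴ.⟦⟧-cong φw²a*r≈1) ιᴴ.1#-homo) ⟩
    (θ H.* θ) H.* H.1#                                 ≈⟨ H.*-identityʳ _ ⟩
    θ H.* θ                                            ∎)
    where open SetoidReasoning H.setoid

  θ²-scalar≉0 : ∀ {t} → ι t H.≈ θ H.* θ → ¬ t K.≈ K.0#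
  θ²-scalar≉0 ιt≈θθ t≈0 = 1≉0 (ι≈0⇒≈0 (H.trans ιᴴ.1#-homo (θθ-cancel
    (H.trans (H.*-identityʳ _) (H.trans (H.sym ιt≈θθ) (H.trans (ιᴴ.⟦⟧-cong t≈0) ιᴴ.0#-homo))))))

  -- InV i is definitionally InSpan (λ p → idx p ℤ.< i).
  open Span V (λ p → f (idx p))

  idx-onto : ∀ z → ℤ.- (+ n) ℤ.≤ z → z ℤ.≤ + n → ∃ λ q → idx q ≡ z
  idx-onto z -n≤z z≤n = fromℕ< k<N , (begin
    + toℕ (fromℕ< k<N) ℤ.- + n    ≡⟨ P.cong (λ i → + i ℤ.- + n) (FinP.toℕ-fromℕ< k<N) ⟩
    + ℤ.∣ z ℤ.+ + n ∣ ℤ.- + n     ≡⟨ P.cong (ℤ._- + n) (ℤP.0≤i⇒+∣i∣≡i 0≤z+n) ⟩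
    (z ℤ.+ + n) ℤ.- + n           ≡⟨ +-‿cancelʳ z (+ n) ⟩
    z                             ∎)
    where
    open P.≡-Reasoning
    0≤z+n : + 0 ℤ.≤ z ℤ.+ + n
    0≤z+n = P.subst (ℤ._≤ z ℤ.+ + n) (ℤP.+-inverseˡ (+ n)) (ℤP.+-monoˡ-≤ (+ n) -n≤z)
    k<N : ℤ.∣ z ℤ.+ + n ∣ < suc (n ℕ.+ n)
    k<N = ℕ.s≤s (ℤP.drop‿+≤+ (P.subst₂ ℤ._≤_ (P.sym (ℤP.0≤i⇒+∣i∣≡i 0≤z+n)) (P.sym (ℤP.pos-+ n n))
                                            (ℤP.+-monoˡ-≤ (+ n) z≤n)))

  idx≤n : ∀ p → idx p ℤ.≤ + n
  idx≤n p = P.subst (idx p ℤ.≤_) (+-‿cancelʳ (+ n) (+ n)) (ℤP.+-monoˡ-≤ (ℤ.- + n)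
    (P.subst (+ toℕ p ℤ.≤_) (ℤP.pos-+ n n) (ℤ.+≤+ (ℕP.≤-pred (FinP.toℕ<n p)))))

  InV-f : ∀ {i z} → i ℤ.≤ z → ℤ.- (+ n) ℤ.≤ z → z ℤ.≤ + n → InV i (f z)
  InV-f {i} {z} i≤z -n≤z z≤n with idx-onto z -n≤z z≤n
  ... | q , idx-q≡z = P.subst (λ z → InV i (f z)) idx-q≡z
                        (InSpan-generator q (ℤP.≤⇒≯ (P.subst (i ℤ.≤_) (P.sym idx-q≡z) i≤z)))

  InV-weaken : ∀ {i i' x} → i' ℤ.≤ i → InV i x → InV i' x
  InV-weaken i'≤i = InSpan-weaken (λ p idx<i' → ℤP.<-≤-trans idx<i' i'≤i)

  InV-f⁺ : ∀ {i} k → k ≤ n → i ℤ.≤ + k → InV i (f (+ k))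
  InV-f⁺ k k≤n i≤k = InV-f i≤k ℤP.neg-≤-pos (ℤ.+≤+ k≤n)

  InV-f⁻ : ∀ {i} r → suc r ≤ n → i ℤ.≤ -[1+ r ] → InV i (f -[1+ r ])
  InV-f⁻ r r<n i≤-r-1 = InV-f i≤-r-1 (ℤP.neg-mono-≤ (ℤ.+≤+ r<n)) ℤ.-≤+

  open ModuleProperties.Halving V half half-eq

  InV-vv : ∀ {i} k → k ≤ n → i ℤ.≤ ℤ.- (+ k) → InV i (vv k)
  InV-vv zero    _   i≤0    = InV-f⁺ 0 ℕ.z≤n i≤0
  InV-vv (suc r) r<n i≤-r-1 = InSpan-cong (half-sum+half-difference (vv (suc r)) (ww (suc r)))
    (InSpan-+ᴹ (InV-f⁻ r r<n i≤-r-1) (InV-f⁺ (suc r) r<n (ℤP.≤-trans i≤-r-1 ℤ.-≤+)))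

  j-0ᴹ : j W.0ᴹ V.≈ᴹ V.0ᴹ
  j-0ᴹ = AbelianGroupProperties.identityˡ-unique V.+ᴹ-abelianGroup (j W.0ᴹ) (j W.0ᴹ)
           (V.≈ᴹ-trans (V.≈ᴹ-sym (j-+ W.0ᴹ W.0ᴹ)) (j-cong (W.+ᴹ-identityˡ W.0ᴹ)))

  j-negᴹ : ∀ x → j (W.-ᴹ x) V.≈ᴹ V.-ᴹ j x
  j-negᴹ x = AbelianGroupProperties.inverseʳ-unique V.+ᴹ-abelianGroup (j x) (j (W.-ᴹ x))
             (V.≈ᴹ-trans (V.≈ᴹ-sym (j-+ x (W.-ᴹ x))) (V.≈ᴹ-trans (j-cong (W.-ᴹ‿inverseʳ x)) j-0ᴹ))

  j-sumᴹ : ∀ {k} (u : Fin k → W.Carrierᴹ) → j (sumᴹ W u) V.≈ᴹ sumᴹ V (λ p → j (u p))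
  j-sumᴹ {zero}  u = j-0ᴹ
  j-sumᴹ {suc k} u = V.≈ᴹ-trans (j-+ _ _) (V.+ᴹ-congˡ (j-sumᴹ (λ p → u (Fin.suc p))))

  j-*ₗ-sumᴹ : ∀ {k} a (u : Fin k → W.Carrierᴹ) → j (a W.*ₗ sumᴹ W u) V.≈ᴹ sumᴹ V (λ p → j (a W.*ₗ u p))
  j-*ₗ-sumᴹ a u = V.≈ᴹ-trans (j-cong (W.≈ᴹ-sym (WP.sumᴹ-*ₗ a u))) (j-sumᴹ (λ p → a W.*ₗ u p))

  Wn : ℕ → W.Carrierᴹ
  Wn k = pick n w W.0ᴹ k

  j-Wn : ∀ k → j (Wn k) V.≈ᴹ ww (suc k)
  j-Wn k with k ℕ.<? n
  ... | yes _ = V.≈ᴹ-refl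
  ... | no  _ = j-0ᴹ

  j-θWn : ∀ k → k < n → j (θ W.*ₗ Wn k) V.≈ᴹ vv k
  j-θWn k k<n with k ℕ.<? n
  ... | yes _   = V.≈ᴹ-refl
  ... | no  k≮n = ⊥-elim (k≮n k<n)

  -- The paper's f_{r+1} = ½(θ w_{r+2} - w_{r+1}) as a vector of W; Wn r is the paper's w_{r+1}.
  fᵂ : ℕ → W.Carrierᴹ
  fᵂ r = ι half W.*ₗ (θ W.*ₗ Wn (suc r) W.+ᴹ W.-ᴹ Wn r)

  j-fᵂ : ∀ r → suc r < n → j (fᵂ r) V.≈ᴹ f (+ suc r)
  j-fᵂ r r+1<n = V.≈ᴹ-trans (j-* half _) (V.*ₗ-congˡ (V.≈ᴹ-trans (j-+ _ _)
    (V.+ᴹ-cong (j-θWn (suc r) r+1<n) (V.≈ᴹ-trans (j-negᴹ _) (V.-ᴹ‿cong (j-Wn r))))))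

  module WithSquare (t : K.Carrier) (ιt≈θθ : ι t H.≈ θ H.* θ) where

    j-θ*ₗθ*ₗ : ∀ x → j (θ W.*ₗ (θ W.*ₗ x)) V.≈ᴹ t V.*ₗ j x
    j-θ*ₗθ*ₗ x = V.≈ᴹ-trans (j-cong (W.≈ᴹ-trans (W.≈ᴹ-sym (W.*ₗ-assoc θ θ x)) (W.*ₗ-congʳ (H.sym ιt≈θθ))))
                            (j-* t x)

    j-θfᵂ : ∀ r → suc r < n → j (θ W.*ₗ fᵂ r) V.≈ᴹ half V.*ₗ (t V.*ₗ ww (suc (suc r)) V.+ᴹ V.-ᴹ vv r)
    j-θfᵂ r r+1<n = begin
      j (θ W.*ₗ (ι half W.*ₗ (θ W.*ₗ Wn (suc r) W.+ᴹ W.-ᴹ Wn r)))  ≈⟨ j-cong (W.*ₗ-comm θ _ _) ⟩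
      j (ι half W.*ₗ (θ W.*ₗ (θ W.*ₗ Wn (suc r) W.+ᴹ W.-ᴹ Wn r))) ≈⟨ j-* half _ ⟩
      half V.*ₗ j (θ W.*ₗ (θ W.*ₗ Wn (suc r) W.+ᴹ W.-ᴹ Wn r))     ≈⟨ V.*ₗ-congˡ (j-cong (W.*ₗ-distribˡ θ _ _)) ⟩
      half V.*ₗ j (θ W.*ₗ (θ W.*ₗ Wn (suc r)) W.+ᴹ θ W.*ₗ W.-ᴹ Wn r) ≈⟨ V.*ₗ-congˡ (j-+ _ _) ⟩
      half V.*ₗ (j (θ W.*ₗ (θ W.*ₗ Wn (suc r))) V.+ᴹ j (θ W.*ₗ W.-ᴹ Wn r))
        ≈⟨ V.*ₗ-congˡ (V.+ᴹ-cong (V.≈ᴹ-trans (j-θ*ₗθ*ₗ _) (V.*ₗ-congˡ (j-Wn (suc r))))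
                                 (V.≈ᴹ-trans (j-cong (WP.*ₗ-negᴹ θ _)) (V.≈ᴹ-trans (j-negᴹ _)
                                   (V.-ᴹ‿cong (j-θWn r (ℕP.<-trans (ℕP.n<1+n r) r+1<n)))))) ⟩
      half V.*ₗ (t V.*ₗ ww (suc (suc r)) V.+ᴹ V.-ᴹ vv r)        ∎
      where open SetoidReasoning V.≈ᴹ-setoid

    θfᵂ-remainder : ℕ → V.Carrierᴹ
    θfᵂ-remainder r = half V.*ₗ (t V.*ₗ (V.-ᴹ f (+ suc (suc r))) V.+ᴹ V.-ᴹ vv r)

    -- Writing w_{r+2} = f_{-(r+2)} - f_{r+2} splits off the f_{-(r+2)}-component.
    j-θfᵂ-split : ∀ r → suc r < n →
                  j (θ W.*ₗ fᵂ r) V.≈ᴹ (half K.* t) V.*ₗ f -[1+ suc r ] V.+ᴹ θfᵂ-remainder r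
    j-θfᵂ-split r r+1<n = V.≈ᴹ-trans (j-θfᵂ r r+1<n)
      (V.≈ᴹ-trans (V.*ₗ-congˡ (V.+ᴹ-congʳ (V.*ₗ-congˡ
                    (V.≈ᴹ-sym (half-sum-half-difference (vv (suc (suc r))) (ww (suc (suc r))))))))
                  (VP.*ₗ-*ₗ-+ᴹ-split half t _ _ _))

    InV-θfᵂ-remainder : ∀ r → suc r < n → InV -[1+ r ] (θfᵂ-remainder r)
    InV-θfᵂ-remainder r r+1<n =
      InSpan-*ₗ half (InSpan-+ᴹ (InSpan-*ₗ t (InSpan-negᴹ (InV-f⁺ (suc (suc r)) r+1<n ℤ.-≤+)))
                                (InSpan-negᴹ (InV-vv r (ℕP.<⇒≤ (ℕP.<-trans (ℕP.n<1+n r) r+1<n))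
                                                     (ℤP.neg-mono-≤ (ℤ.+≤+ (ℕP.n≤1+n r))))))

    InV-θfᵂ : ∀ r → suc r < n → InV -[1+ suc r ] (j (θ W.*ₗ fᵂ r))
    InV-θfᵂ r r+1<n = InSpan-cong (V.≈ᴹ-sym (j-θfᵂ-split r r+1<n))
      (InSpan-+ᴹ (InSpan-*ₗ _ (InV-f⁻ (suc r) r+1<n ℤP.≤-refl))
                 (InV-weaken (ℤ.-≤- (ℕP.n≤1+n r)) (InV-θfᵂ-remainder r r+1<n)))

  module Annihilator (m : ℕ) (m<n : m < n) where

    ψ : V.Carrierᴹ → K.Carrier
    ψ x = φ x (f (+ suc m))

    ψ-linear : IsLinearFunctional V ψ
    ψ-linear = φ-linearˡ (f (+ suc m))

    open IsLinearFunctional ψ-linear using (*ₗ-+ᴹ-homo; *ₗ-sub-homo)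
    open SetoidReasoning K.setoid

    a : K.Carrier
    a = φ (vv (suc m)) (vv (suc m))

    private
      half*[0+0] : ∀ {x y} → x K.≈ K.0# → y K.≈ K.0# → half K.* (x K.+ y) K.≈ K.0#
      half*[0+0] x≈0 y≈0 = K.trans (K.*-congˡ (K.trans (K.+-cong x≈0 y≈0) (K.+-identityˡ K.0#))) (K.zeroʳ half)

      half*[0-0] : ∀ {x y} → x K.≈ K.0# → y K.≈ K.0# → half K.* (x K.- y) K.≈ K.0#
      half*[0-0] x≈0 y≈0 = half*[0+0] x≈0 (K.trans (K.-‿cong y≈0) KP.-0#≈0#)

    ψ-expand : ∀ x → ψ x K.≈ half K.* (φ x (vv (suc m)) K.- φ x (ww (suc m)))
    ψ-expand x = IsLinearFunctional.*ₗ-sub-homo (φ-linearʳ x) half _ _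

    ψ-vv : ∀ k → k ≢ suc m → k ≤ n → ψ (vv k) K.≈ K.0#
    ψ-vv k k≢m+1 k≤n = K.trans (ψ-expand (vv k))
      (half*[0-0] (φ-vv-vv k (suc m) k≢m+1 k≤n m<n) (φ-vv-ww k (suc m)))

    ψ-ww : ∀ k → k ≢ suc m → ψ (ww k) K.≈ K.0#
    ψ-ww k k≢m+1 = K.trans (ψ-expand (ww k))
      (half*[0-0] (K.trans (φ-sym _ _) (φ-vv-ww (suc m) k)) (φ-ww-ww k (suc m) k≢m+1))

    ψ-vv-same : ψ (vv (suc m)) K.≈ half K.* a
    ψ-vv-same = K.trans (ψ-expand _) (K.*-congˡ
      (K.trans (K.+-congˡ (K.trans (K.-‿cong (φ-vv-ww (suc m) (suc m))) KP.-0#≈0#)) (K.+-identityʳ a)))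

    ψ-ww-same : ψ (ww (suc m)) K.≈ half K.* a
    ψ-ww-same = begin
      ψ (ww (suc m))                                        ≈⟨ ψ-expand _ ⟩
      half K.* (φ (ww (suc m)) (vv (suc m)) K.- φ (ww (suc m)) (ww (suc m)))
        ≈⟨ K.*-congˡ (K.+-cong (K.trans (φ-sym _ _) (φ-vv-ww (suc m) (suc m))) (K.-‿cong φww≈-a)) ⟩
      half K.* (K.0# K.+ K.- (K.- a))                       ≈⟨ K.*-congˡ (K.trans (K.+-identityˡ _) (KP.-‿involutive a)) ⟩
      half K.* a                                            ∎
      where
      φww≈-a : φ (ww (suc m)) (ww (suc m)) K.≈ K.- a
      φww≈-a = KP.+-inverseˡ-unique _ a (φ-ww+φ-vv m m<n)

    ψ-f-self : ψ (f (+ suc m)) K.≈ K.0#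
    ψ-f-self = begin
      ψ (f (+ suc m))                              ≈⟨ *ₗ-sub-homo half _ _ ⟩
      half K.* (ψ (vv (suc m)) K.- ψ (ww (suc m))) ≈⟨ K.*-congˡ (K.+-cong ψ-vv-same (K.-‿cong ψ-ww-same)) ⟩
      half K.* (half K.* a K.- half K.* a)         ≈⟨ K.*-congˡ (K.-‿inverseʳ _) ⟩
      half K.* K.0#                                ≈⟨ K.zeroʳ half ⟩
      K.0#                                         ∎

    ψ-f-opposite : ψ (f -[1+ m ]) K.≈ half K.* a
    ψ-f-opposite = begin
      ψ (f -[1+ m ])                               ≈⟨ *ₗ-+ᴹ-homo half _ _ ⟩
      half K.* (ψ (vv (suc m)) K.+ ψ (ww (suc m))) ≈⟨ K.*-congˡ (K.+-cong ψ-vv-same ψ-ww-same) ⟩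
      half K.* (half K.* a K.+ half K.* a)         ≈⟨ K.*-congˡ (half-double a) ⟩
      half K.* a                                   ∎

    ψ-f-opposite≉0 : ¬ ψ (f -[1+ m ]) K.≈ K.0#
    ψ-f-opposite≉0 ψ≈0 = nonzero-* half≉0 (vv-anisotropic (suc m) m<n) (K.trans (K.sym ψ-f-opposite) ψ≈0)

    ψ-f : ∀ z → ℤ.- (+ m) ℤ.≤ z → z ℤ.≤ + n → ψ (f z) K.≈ K.0#
    ψ-f (+ zero)    _ _ = ψ-vv 0 (λ ()) ℕ.z≤n
    ψ-f (+ suc i)   _ (ℤ.+≤+ i<n) with i ℕ.≟ m
    ... | yes P.refl = ψ-f-self
    ... | no  i≢m    = K.trans (*ₗ-sub-homo half _ _)
      (half*[0-0] (ψ-vv (suc i) (i≢m ∘ ℕP.suc-injective) i<n) (ψ-ww (suc i) (i≢m ∘ ℕP.suc-injective)))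
    ψ-f -[1+ i ] -m≤-i-1 _ = K.trans (*ₗ-+ᴹ-homo half _ _)
      (half*[0+0] (ψ-vv (suc i) (λ i+1≡m+1 → ℕP.<-irrefl (ℕP.suc-injective i+1≡m+1) i<m) (ℕP.<-trans i<m m<n))
                  (ψ-ww (suc i) (λ i+1≡m+1 → ℕP.<-irrefl (ℕP.suc-injective i+1≡m+1) i<m)))
      where
      i<m : i < m
      i<m = ℤP.drop‿+≤+ (P.subst₂ ℤ._≤_ P.refl (ℤP.neg-involutive (+ m)) (ℤP.neg-mono-≤ -m≤-i-1))

    InV-annihilated : ∀ {x} → InV (ℤ.- (+ m)) x → ψ x K.≈ K.0#
    InV-annihilated = InSpan-annihilated (λ p → idx p ℤ.<? ℤ.- (+ m)) ψ-linear
                        (λ p idx≮-m → ψ-f (idx p) (ℤP.≮⇒≥ idx≮-m) (idx≤n p))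

  module Witness (m' : ℕ) (m<n : suc m' < n) (c : ℕ → K.Carrier) (cₘ≉0 : ¬ c (suc m') K.≈ K.0#) where

    m : ℕ
    m = suc m'

    t : K.Carrier
    t = proj₁ (θ²-scalar (fromℕ< m<n))

    open WithSquare t (proj₂ (θ²-scalar (fromℕ< m<n)))
    open Annihilator m m<n

    term : ℕ → W.Carrierᴹ
    term r = ι (c (suc r)) W.*ₗ fᵂ r

    x : W.Carrierᴹ
    x = sumᴹ W {m} (λ i → term (toℕ i))

    toℕ<m⇒<n : ∀ (i : Fin m) → suc (toℕ i) < n
    toℕ<m⇒<n i = ℕP.≤-<-trans (FinP.toℕ<n i) m<n

    toℕ<m'⇒<n : ∀ (i : Fin m') → suc (toℕ i) < n
    toℕ<m'⇒<n i = ℕP.≤-<-trans (FinP.toℕ<n i) (ℕP.<-trans (ℕP.n<1+n m') m<n)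

    j-x : j x V.≈ᴹ sumᴹ V (λ (i : Fin m) → c (suc (toℕ i)) V.*ₗ f (+ suc (toℕ i)))
    j-x = V.≈ᴹ-trans (j-sumᴹ {m} (λ i → term (toℕ i)))
            (VP.sumᴹ-cong (λ i → V.≈ᴹ-trans (j-* (c (suc (toℕ i))) _) (V.*ₗ-congˡ (j-fᵂ (toℕ i) (toℕ<m⇒<n i)))))

    j-θterm : ∀ r → j (θ W.*ₗ term r) V.≈ᴹ c (suc r) V.*ₗ j (θ W.*ₗ fᵂ r)
    j-θterm r = V.≈ᴹ-trans (j-cong (W.*ₗ-comm θ _ _)) (j-* _ _)

    prefix : W.Carrierᴹ
    prefix = sumᴹ W {m'} (λ i → term (toℕ i))

    InV-θprefix : InV -[1+ m' ] (j (θ W.*ₗ prefix))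
    InV-θprefix = InSpan-cong (V.≈ᴹ-sym (j-*ₗ-sumᴹ {m'} θ (λ i → term (toℕ i)))) (InSpan-sumᴹ _ (λ i →
      InSpan-cong (V.≈ᴹ-sym (j-θterm (toℕ i))) (InSpan-*ₗ _
        (InV-weaken (ℤ.-≤- (FinP.toℕ<n i)) (InV-θfᵂ (toℕ i) (toℕ<m'⇒<n i))))))

    s : K.Carrier
    s = c m K.* (half K.* t)

    s≉0 : ¬ s K.≈ K.0#
    s≉0 = nonzero-* cₘ≉0 (nonzero-* half≉0 (θ²-scalar≉0 (proj₂ (θ²-scalar (fromℕ< m<n)))))

    θx-rest : V.Carrierᴹ
    θx-rest = j (θ W.*ₗ prefix) V.+ᴹ c m V.*ₗ θfᵂ-remainder m'

    InV-θx-rest : InV -[1+ m' ] θx-rest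
    InV-θx-rest = InSpan-+ᴹ InV-θprefix (InSpan-*ₗ _ (InV-θfᵂ-remainder m' m<n))

    θx-decomposition : j (θ W.*ₗ x) V.≈ᴹ θx-rest V.+ᴹ s V.*ₗ f -[1+ m ]
    θx-decomposition = begin
      j (θ W.*ₗ x)                      ≈⟨ j-cong (W.*ₗ-congˡ (WP.sumᴹ-snoc m' term)) ⟩
      j (θ W.*ₗ (prefix W.+ᴹ term m'))  ≈⟨ V.≈ᴹ-trans (j-cong (W.*ₗ-distribˡ θ _ _)) (j-+ _ _) ⟩
      j (θ W.*ₗ prefix) V.+ᴹ j (θ W.*ₗ term m')
        ≈⟨ V.+ᴹ-congˡ (V.≈ᴹ-trans (j-θterm m') (V.*ₗ-congˡ (j-θfᵂ-split m' m<n))) ⟩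
      j (θ W.*ₗ prefix) V.+ᴹ c m V.*ₗ ((half K.* t) V.*ₗ f -[1+ m ] V.+ᴹ θfᵂ-remainder m')
        ≈⟨ V.+ᴹ-congˡ (V.≈ᴹ-trans (V.*ₗ-distribˡ _ _ _) (V.+ᴹ-congʳ (V.≈ᴹ-sym (V.*ₗ-assoc _ _ _)))) ⟩
      j (θ W.*ₗ prefix) V.+ᴹ (s V.*ₗ f -[1+ m ] V.+ᴹ c m V.*ₗ θfᵂ-remainder m')
        ≈⟨ CommutativeSemigroupProperties.x∙yz≈xz∙y (AbelianGroup.commutativeSemigroup V.+ᴹ-abelianGroup) _ _ _ ⟩
      θx-rest V.+ᴹ s V.*ₗ f -[1+ m ]    ∎
      where open SetoidReasoning V.≈ᴹ-setoid

    InV-θx : InV -[1+ m ] (j (θ W.*ₗ x))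
    InV-θx = InSpan-cong (V.≈ᴹ-sym θx-decomposition)
      (InSpan-+ᴹ (InV-weaken (ℤ.-≤- (ℕP.n≤1+n m')) InV-θx-rest) (InSpan-*ₗ s (InV-f⁻ m m<n ℤP.≤-refl)))

    θx∉ : ¬ InV (ℤ.- (+ m)) (j (θ W.*ₗ x))
    θx∉ θx∈ = nonzero-* s≉0 ψ-f-opposite≉0 (begin
      s K.* ψ (f -[1+ m ])                ≈⟨ K.+-identityˡ _ ⟨
      K.0# K.+ s K.* ψ (f -[1+ m ])       ≈⟨ K.+-congʳ (InV-annihilated InV-θx-rest) ⟨
      ψ θx-rest K.+ s K.* ψ (f -[1+ m ])  ≈⟨ K.+-congˡ (IsLinearFunctional.*ₗ-homo ψ-linear s _) ⟨
      ψ θx-rest K.+ ψ (s V.*ₗ f -[1+ m ]) ≈⟨ IsLinearFunctional.+ᴹ-homo ψ-linear _ _ ⟨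
      ψ (θx-rest V.+ᴹ s V.*ₗ f -[1+ m ])  ≈⟨ IsLinearFunctional.cong ψ-linear θx-decomposition ⟨
      ψ (j (θ W.*ₗ x))                    ≈⟨ InV-annihilated θx∈ ⟩
      K.0#                                ∎)
      where open SetoidReasoning K.setoid

-- Imported only here: above, -_ would clash with the negation of the rings.
open import Data.Integer using (-_)

mainTheorem13 : (S : Setup) → let open Setup S in
    ∀ (m : ℕ) → 1 ≤ m → m < n →
    ∀ (c : ℕ → K.Carrier) → ¬ (c m K.≈ K.0#) →
    Σ W.Carrierᴹ (λ x →
        (j x V.≈ᴹ sumᴹ V (λ (i : Fin m) → c (suc (toℕ i)) V.*ₗ f (+ suc (toℕ i))))
      × InV -[1+ m ] (j (θ W.*ₗ x))
      × ¬ InV (- (+ m)) (j (θ W.*ₗ x)))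
mainTheorem13 S zero    ()  _   _ _
mainTheorem13 S (suc m') _   m<n c cₘ≉0 = x , j-x , InV-θx , θx∉
  where open SetupProperties.Witness S m' m<n c cₘ≉0
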